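{- No tree graph is in $\mathcal{U}$.
   Context: A clause is a disjunction of literals (Boolean variables or their negations); a reduced 2-CNF is a conjunction of clauses each consisting of exactly two literals on two distinct variables, with no repeated clause. With $|x|=|\neg x|=x$, the associated multigraph of such a CNF has as vertices the variables occurring in it and one edge $\{|a|,|b|\}$ per clause $(a\vee b)$; the CNF is simple if it has no multiple edges, in which case the graph is denoted $\mathcal{G}(S)$. $\mathcal{U}$ is the family of graphs $\mathcal{G}(S)$ with $S$ an unsatisfiable simple 2-CNF. -}

module Defs where

open import Data.Nat using (ℕ; zero; suc; _≡ᵇ_)
open import Data.Bool using (Bool; true; false; not; _∨_; T)
open import Data.Fin using (Fin; zero; suc; inject₁; fromℕ)
open import Data.List using (List)
open import Data.Bool.ListAction using (any)
open import Data.List.Relation.Unary.All using (All)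
open import Data.List.Relation.Unary.Any using (Any)
open import Data.List.Relation.Unary.AllPairs using (AllPairs)
open import Data.Product using (Σ; ∃; _×_; _,_; proj₁)
open import Data.Sum using (_⊎_)
open import Relation.Binary.PropositionalEquality using (_≡_; _≢_)
open import Relation.Nullary using (¬_)
open import Function.Definitions using (Injective)
open import Function.Bundles using (Bijection; _⤖_)
open import Function.Bundles using (_⇔_)

data Lit : Set where
  pos : ℕ → Lit
  neg : ℕ → Lit

∣_∣ : Lit → ℕ
∣ pos x ∣ = x
∣ neg x ∣ = x

Clause : Set
Clause = Lit × Lit

CNF : Set
CNF = List Clause

fst : Clause → Lit
fst (a , _) = a

snd : Clause → Lit
snd (_ , b) = b

-- clauses are unordered: (a ∨ b) is the same clause as (b ∨ a)
SameClause : Clause → Clause → Set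
SameClause (a , b) (c , d) = (a ≡ c × b ≡ d) ⊎ (a ≡ d × b ≡ c)

Reduced : CNF → Set
Reduced S = All (λ c → ∣ fst c ∣ ≢ ∣ snd c ∣) S
          × AllPairs (λ c d → ¬ SameClause c d) S

SameEdge : Clause → Clause → Set
SameEdge (a , b) (c , d) =
  (∣ a ∣ ≡ ∣ c ∣ × ∣ b ∣ ≡ ∣ d ∣) ⊎ (∣ a ∣ ≡ ∣ d ∣ × ∣ b ∣ ≡ ∣ c ∣)

-- simple: the associated multigraph has no multiple edges
Simple : CNF → Set
Simple S = AllPairs (λ c d → ¬ SameEdge c d) S

Assignment : Set
Assignment = ℕ → Bool

evalLit : Assignment → Lit → Bool
evalLit σ (pos x) = σ x
evalLit σ (neg x) = not (σ x)

Satisfies : Assignment → CNF → Set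
Satisfies σ S = All (λ c → T (evalLit σ (fst c) ∨ evalLit σ (snd c))) S

Satisfiable : CNF → Set
Satisfiable S = ∃ λ σ → Satisfies σ S

Unsatisfiable : CNF → Set
Unsatisfiable S = ¬ Satisfiable S

record FinGraph : Set₁ where
  field
    n    : ℕ
    Adj  : Fin n → Fin n → Set
    sym  : ∀ {u v} → Adj u v → Adj v u
    irr  : ∀ {u} → ¬ Adj u u

data Walk {V : Set} (Adj : V → V → Set) : V → V → Set where
  here : ∀ {u} → Walk Adj u u
  step : ∀ {u v w} → Adj u v → Walk Adj v w → Walk Adj u w

-- a cycle of length m+3: injective closed sequence of adjacent vertices
record Cycle {V : Set} (Adj : V → V → Set) : Set where
  field
    m     : ℕ
    vtx   : Fin (suc (suc (suc m))) → V
    inj   : Injective _≡_ _≡_ vtx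
    edge  : ∀ (i : Fin (suc (suc m))) → Adj (vtx (inject₁ i)) (vtx (suc i))
    close : Adj (vtx (fromℕ (suc (suc m)))) (vtx zero)

IsTree : FinGraph → Set
IsTree G = (Σ ℕ λ k → n ≡ suc k)
         × (∀ u v → Walk Adj u v)
         × ¬ Cycle Adj
  where open FinGraph G

-- x occurs in S (Boolean, so that vertices have unique witnesses)
occursIn : ℕ → CNF → Bool
occursIn x S = any (λ c → (∣ fst c ∣ ≡ᵇ x) ∨ (∣ snd c ∣ ≡ᵇ x)) S

VarOf : CNF → Set
VarOf S = Σ ℕ λ x → T (occursIn x S)

AdjOf : (S : CNF) → VarOf S → VarOf S → Set
AdjOf S (x , _) (y , _) =
  Any (λ c → (∣ fst c ∣ ≡ x × ∣ snd c ∣ ≡ y) ⊎ (∣ fst c ∣ ≡ y × ∣ snd c ∣ ≡ x)) S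

record Iso (G : FinGraph) (S : CNF) : Set where
  open FinGraph G
  field
    bij      : Fin n ⤖ VarOf S
  open Bijection bij using (to)
  field
    preserve : ∀ u v → Adj u v ⇔ AdjOf S (to u) (to v)

InU : FinGraph → Set
InU G = Σ CNF λ S → Reduced S × Simple S × Unsatisfiable S × Iso G S

-- A 2-CNF whose graph is a forest is satisfiable, even with the value of any one variable
-- prescribed. Add the clauses one at a time: acyclicity means each new clause (a ∨ b) joins
-- two distinct components of the clauses already present, so one of its literals, say b,
-- lies in a component not containing the prescribed variable z. Take an assignment
-- satisfying the old clauses with the prescribed value at z and another one making b true,
-- and use the first on the component of z and the second elsewhere: no old clause crosses
-- components, so the result satisfies every clause.
module Submission where

open import Defs
open import Data.Bool using (Bool; true; false; not; _∨_; T; if_then_else_)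
open import Data.Bool.Properties using (T-∨; T-≡)
open import Data.Empty using (⊥-elim)
open import Data.Fin using (Fin; zero; suc; inject₁; fromℕ)
open import Data.List using (List; []; _∷_; length; lookup)
open import Data.List.Membership.Propositional using (_∈_)
open import Data.List.Membership.Propositional.Properties using (∈-lookup)
open import Data.List.Relation.Unary.All as All using (All; []; _∷_)
open import Data.List.Relation.Unary.All.Properties using (All¬⇒¬Any; ¬Any⇒All¬)
open import Data.List.Relation.Unary.Any as Any using (Any; here; there)
open import Data.List.Relation.Unary.Any.Properties using (any⁺)
open import Data.List.Relation.Unary.Unique.Propositional using (Unique; []; _∷_)
open import Data.Nat using (ℕ; _≟_; _≡ᵇ_)
open import Data.Nat.Properties using (≡⇒≡ᵇ)
open import Data.Product using (Σ; ∃; _×_; _,_; proj₁; proj₂)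
open import Data.Sum using (_⊎_; inj₁; inj₂)
open import Data.Unit using (⊤; tt)
open import Function using (_∘_; id; const)
open import Function.Bundles using (Bijection; Equivalence)
open import Function.Definitions using (Injective)
open import Relation.Binary.Definitions using (DecidableEquality)
open import Relation.Binary.PropositionalEquality
open import Relation.Nullary using (¬_; yes; no; does)
open import Relation.Nullary.Decidable using (dec-true; dec-false)

private
  variable
    V W : Set
    R Q : V → V → Set

_++ᵂ_ : ∀ {u v w} → Walk R u v → Walk R v w → Walk R u w
here     ++ᵂ q = q
step r p ++ᵂ q = step r (p ++ᵂ q)

mapᵂ : (∀ {u v} → R u v → Q u v) → ∀ {u v} → Walk R u v → Walk Q u v
mapᵂ f here       = here
mapᵂ f (step r p) = step (f r) (mapᵂ f p)

Cycle-map : {R : V → V → Set} {Q : W → W → Set} (f : V → W) → Injective _≡_ _≡_ f →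
            (∀ {u v} → R u v → Q (f u) (f v)) → Cycle R → Cycle Q
Cycle-map f f-inj f-hom cy = record
  { m     = m
  ; vtx   = f ∘ vtx
  ; inj   = inj ∘ f-inj
  ; edge  = f-hom ∘ edge
  ; close = f-hom close
  }
  where open Cycle cy

Path : (V → V → Set) → V → List V → V → Set
Path R u []       y = u ≡ y
Path R u (v ∷ vs) y = R u v × Path R v vs y

Path-map : (∀ {u v} → R u v → Q u v) → ∀ {u vs y} → Path R u vs y → Path Q u vs y
Path-map f {vs = []}    p       = p
Path-map f {vs = _ ∷ _} (r , p) = f r , Path-map f p

Path-edge : ∀ {u vs y} → Path R u vs y → (i : Fin (length vs)) →
            R (lookup (u ∷ vs) (inject₁ i)) (lookup (u ∷ vs) (suc i))
Path-edge {vs = _ ∷ _} (r , p) zero    = r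
Path-edge {vs = _ ∷ _} (r , p) (suc i) = Path-edge p i

Path-last : ∀ {u vs y} → Path R u vs y → lookup (u ∷ vs) (fromℕ (length vs)) ≡ y
Path-last {vs = []}    p       = p
Path-last {vs = _ ∷ _} (r , p) = Path-last p

lookup-injective : ∀ {xs : List V} → Unique xs → Injective _≡_ _≡_ (lookup xs)
lookup-injective (_  ∷ _)  {zero}  {zero}  e = refl
lookup-injective (x∉ ∷ _)  {zero}  {suc j} e = ⊥-elim (All.lookup x∉ (∈-lookup j) e)
lookup-injective (x∉ ∷ _)  {suc i} {zero}  e = ⊥-elim (All.lookup x∉ (∈-lookup i) (sym e))
lookup-injective (_  ∷ xs) {suc i} {suc j} e = cong suc (lookup-injective xs e)

Path⇒Cycle : ∀ {x v₁ v₂ vs y} → Path R x (v₁ ∷ v₂ ∷ vs) y → Unique (x ∷ v₁ ∷ v₂ ∷ vs) →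
             R y x → Cycle R
Path⇒Cycle {R = R} {x = x} {v₁} {v₂} {vs} p unique ryx = record
  { m     = length vs
  ; vtx   = lookup (x ∷ v₁ ∷ v₂ ∷ vs)
  ; inj   = lookup-injective unique
  ; edge  = Path-edge p
  ; close = subst (λ t → R t x) (sym (Path-last p)) ryx
  }

SimplePath : (V → V → Set) → V → V → Set
SimplePath {V} R u y = Σ (List V) λ vs → Path R u vs y × Unique (u ∷ vs)

module _ {V : Set} (_≟ᵛ_ : DecidableEquality V) {R Q : V → V → Set} where
  open import Data.List.Membership.DecPropositional _≟ᵛ_ using (_∈?_)

  SimplePath-from : ∀ {u v vs y} → Path R v vs y → Unique (v ∷ vs) → u ∈ v ∷ vs →
                    SimplePath R u y
  SimplePath-from {vs = vs}    p       unique       (here refl) = vs , p , unique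
  SimplePath-from {vs = _ ∷ _} (_ , p) (_ ∷ unique) (there u∈)  = SimplePath-from p unique u∈

  -- Loop erasure: when the start vertex reappears on the path, drop the loop through it.
  Walk⇒SimplePath : ∀ {u y} → Walk R u y → SimplePath R u y
  Walk⇒SimplePath here = [] , refl , [] ∷ []
  Walk⇒SimplePath {u = u} (step {v = v} r w) with Walk⇒SimplePath w
  ... | vs , p , unique with u ∈? v ∷ vs
  ...   | yes u∈ = SimplePath-from p unique u∈
  ...   | no  u∉ = v ∷ vs , (r , p) , ¬Any⇒All¬ (v ∷ vs) u∉ ∷ unique

  Walk⇒Cycle : (∀ {u v} → R u v → Q u v) → ∀ {a b} → Walk R a b → a ≢ b → ¬ R a b →
               Q b a → Cycle Q
  Walk⇒Cycle R⊆Q w a≢b ¬rab qba with Walk⇒SimplePath w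
  ... | []        , a≡b        , _      = ⊥-elim (a≢b a≡b)
  ... | _ ∷ []    , (r , refl) , _      = ⊥-elim (¬rab r)
  ... | _ ∷ _ ∷ _ , p          , unique = Path⇒Cycle (Path-map R⊆Q p) unique qba

Edge : CNF → ℕ → ℕ → Set
Edge S u v = Any (λ c → (∣ fst c ∣ ≡ u × ∣ snd c ∣ ≡ v) ⊎ (∣ fst c ∣ ≡ v × ∣ snd c ∣ ≡ u)) S

Edge-occursIn : ∀ {S u v} → Edge S u v → T (occursIn v S)
Edge-occursIn {u = u} {v} = any⁺ _ ∘ Any.map (λ {c} → endpoint c)
  where
  endpoint : ∀ c → (∣ fst c ∣ ≡ u × ∣ snd c ∣ ≡ v) ⊎ (∣ fst c ∣ ≡ v × ∣ snd c ∣ ≡ u) →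
             T ((∣ fst c ∣ ≡ᵇ v) ∨ (∣ snd c ∣ ≡ᵇ v))
  endpoint _ (inj₁ (_ , q)) = Equivalence.from T-∨ (inj₂ (≡⇒≡ᵇ _ _ q))
  endpoint _ (inj₂ (p , _)) = Equivalence.from T-∨ (inj₁ (≡⇒≡ᵇ _ _ p))

Cycle-Edge⇒Cycle-AdjOf : ∀ S → Cycle (Edge S) → Cycle (AdjOf S)
Cycle-Edge⇒Cycle-AdjOf S cy = record
  { m     = m
  ; vtx   = λ i → vtx i , occurs i
  ; inj   = inj ∘ cong proj₁
  ; edge  = edge
  ; close = close
  }
  where
  open Cycle cy
  occurs : ∀ i → T (occursIn (vtx i) S)
  occurs zero    = Edge-occursIn close
  occurs (suc i) = Edge-occursIn (edge i)

Iso-reflects-Cycle : ∀ {G S} → Iso G S → Cycle (AdjOf S) → Cycle (FinGraph.Adj G)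
Iso-reflects-Cycle {G} {S} iso = Cycle-map to⁻ to⁻-injective to⁻-hom
  where
  open Iso iso
  open Bijection bij using (to; to⁻; strictlySurjective)
  to∘to⁻ : ∀ x → to (to⁻ x) ≡ x
  to∘to⁻ = proj₂ ∘ strictlySurjective
  to⁻-injective : Injective _≡_ _≡_ to⁻
  to⁻-injective {x} {y} e = trans (sym (to∘to⁻ x)) (trans (cong to e) (to∘to⁻ y))
  to⁻-hom : ∀ {x y} → AdjOf S x y → FinGraph.Adj G (to⁻ x) (to⁻ y)
  to⁻-hom {x} {y} e = Equivalence.from (preserve (to⁻ x) (to⁻ y))
                        (subst₂ (AdjOf S) (sym (to∘to⁻ x)) (sym (to∘to⁻ y)) e)

¬SameEdge⇒¬Edge : ∀ {a b S} → All (λ d → ¬ SameEdge (a , b) d) S → ¬ Edge S ∣ a ∣ ∣ b ∣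
¬SameEdge⇒¬Edge {a} {b} = All¬⇒¬Any ∘ All.map (λ {d} → _∘ sameEdge d)
  where
  sameEdge : ∀ d → (∣ fst d ∣ ≡ ∣ a ∣ × ∣ snd d ∣ ≡ ∣ b ∣) ⊎ (∣ fst d ∣ ≡ ∣ b ∣ × ∣ snd d ∣ ≡ ∣ a ∣) →
             SameEdge (a , b) d
  sameEdge _ (inj₁ (p , q)) = inj₁ (sym p , sym q)
  sameEdge _ (inj₂ (p , q)) = inj₂ (sym q , sym p)

redirect : ℕ → ℕ → ℕ → ℕ
redirect p q k with k ≟ q
... | yes _ = p
... | no  _ = k

-- A representative of the component of x in the graph of S: each clause (a ∨ b) merges the
-- component of b into that of a.
component : CNF → ℕ → ℕ
component []            x = x
component ((a , b) ∷ S) x = redirect (component S ∣ a ∣) (component S ∣ b ∣) (component S x)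

component-respects-clauses : ∀ S → All (λ c → component S ∣ fst c ∣ ≡ component S ∣ snd c ∣) S
component-respects-clauses []            = []
component-respects-clauses ((a , b) ∷ S) =
  merged ∷ All.map (cong (redirect _ _)) (component-respects-clauses S)
  where
  merged : redirect (component S ∣ a ∣) (component S ∣ b ∣) (component S ∣ a ∣)
         ≡ redirect (component S ∣ a ∣) (component S ∣ b ∣) (component S ∣ b ∣)
  merged with component S ∣ a ∣ ≟ component S ∣ b ∣ | component S ∣ b ∣ ≟ component S ∣ b ∣
  ... | _     | no b≢b = ⊥-elim (b≢b refl)
  ... | yes _ | yes _  = refl
  ... | no  _ | yes _  = refl

component-connected : ∀ S {u w} → component S u ≡ component S w → Walk (Edge S) u w
component-connected []            refl = here
component-connected ((a , b) ∷ S) {u} {w} u∼w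
  with component S u ≟ component S ∣ b ∣ | component S w ≟ component S ∣ b ∣
... | yes u∼b | yes w∼b = mapᵂ there (component-connected S (trans u∼b (sym w∼b)))
... | no  _   | no  _   = mapᵂ there (component-connected S u∼w)
... | yes u∼b | no  _   =
  mapᵂ there (component-connected S u∼b)
  ++ᵂ step (here (inj₂ (refl , refl))) (mapᵂ there (component-connected S u∼w))
... | no  _   | yes w∼b =
  mapᵂ there (component-connected S u∼w)
  ++ᵂ step (here (inj₁ (refl , refl))) (mapᵂ there (component-connected S (sym w∼b)))

Forest : CNF → Set
Forest []            = ⊤
Forest ((a , b) ∷ S) = component S ∣ a ∣ ≢ component S ∣ b ∣ × Forest S

acyclic⇒Forest : ∀ S → All (λ c → ∣ fst c ∣ ≢ ∣ snd c ∣) S → Simple S → ¬ Cycle (Edge S) →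
                 Forest S
acyclic⇒Forest []            _                _              _       = tt
acyclic⇒Forest ((a , b) ∷ S) (a≢b ∷ distinct) (new ∷ simple) acyclic =
  joins , acyclic⇒Forest S distinct simple (acyclic ∘ Cycle-map id id there)
  where
  joins : component S ∣ a ∣ ≢ component S ∣ b ∣
  joins a∼b = acyclic (Walk⇒Cycle _≟_ there (component-connected S a∼b) a≢b
                         (¬SameEdge⇒¬Edge {a} {b} new) (here (inj₂ (refl , refl))))

satisfyingValue : Lit → Bool
satisfyingValue (pos _) = true
satisfyingValue (neg _) = false

evalLit-satisfyingValue : ∀ σ a → σ ∣ a ∣ ≡ satisfyingValue a → evalLit σ a ≡ true
evalLit-satisfyingValue σ (pos x) e = e
evalLit-satisfyingValue σ (neg x) e = cong not e

splice : (ℕ → Bool) → Assignment → Assignment → Assignment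
splice P σ₁ σ₂ x = if P x then σ₁ x else σ₂ x

evalLit-splice : ∀ P σ₁ σ₂ a →
                 evalLit (splice P σ₁ σ₂) a ≡ (if P ∣ a ∣ then evalLit σ₁ a else evalLit σ₂ a)
evalLit-splice P σ₁ σ₂ (pos x) = refl
evalLit-splice P σ₁ σ₂ (neg x) with P x
... | true  = refl
... | false = refl

splice-true : ∀ P σ₁ σ₂ {x} → P x ≡ true → splice P σ₁ σ₂ x ≡ σ₁ x
splice-true P σ₁ σ₂ e rewrite e = refl

splice-false : ∀ P σ₁ σ₂ {x} → P x ≡ false → splice P σ₁ σ₂ x ≡ σ₂ x
splice-false P σ₁ σ₂ e rewrite e = refl

splice-satisfies : ∀ P {σ₁ σ₂} S → All (λ c → P ∣ fst c ∣ ≡ P ∣ snd c ∣) S →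
                   Satisfies σ₁ S → Satisfies σ₂ S → Satisfies (splice P σ₁ σ₂) S
splice-satisfies P []            []       []         []         = []
splice-satisfies P {σ₁} {σ₂} ((a , b) ∷ S) (e ∷ es) (t₁ ∷ ts₁) (t₂ ∷ ts₂) =
  clause ∷ splice-satisfies P S es ts₁ ts₂
  where
  clause : T (evalLit (splice P σ₁ σ₂) a ∨ evalLit (splice P σ₁ σ₂) b)
  clause rewrite evalLit-splice P σ₁ σ₂ a | evalLit-splice P σ₁ σ₂ b | e with P ∣ b ∣
  ... | true  = t₁
  ... | false = t₂

sameComponent : CNF → ℕ → ℕ → Bool
sameComponent S z x = does (component S x ≟ component S z)

splice-components : ∀ S z {σ₁ σ₂} → Satisfies σ₁ S → Satisfies σ₂ S →
                    Satisfies (splice (sameComponent S z) σ₁ σ₂) S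
splice-components S z =
  splice-satisfies (sameComponent S z) S
    (All.map (cong (λ k → does (k ≟ component S z))) (component-respects-clauses S))

Forest⇒Satisfiable-at : ∀ S → Forest S → ∀ z v → ∃ λ σ → Satisfies σ S × σ z ≡ v
Forest⇒Satisfiable-at []            _              z v = const v , [] , refl
Forest⇒Satisfiable-at ((a , b) ∷ S) (a≁b , forest) z v =
  let ℓ , ℓ≁z , ℓ-satisfies = literalAwayFrom-z
      σ₁ , sat₁ , σ₁z = Forest⇒Satisfiable-at S forest z v
      σ₂ , sat₂ , σ₂ℓ = Forest⇒Satisfiable-at S forest ∣ ℓ ∣ (satisfyingValue ℓ)
      P = sameComponent S z
      σ = splice P σ₁ σ₂
      σz = splice-true P σ₁ σ₂ (dec-true (component S z ≟ component S z) refl)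
      σℓ = splice-false P σ₁ σ₂ (dec-false (component S ∣ ℓ ∣ ≟ component S z) ℓ≁z)
  in σ , ℓ-satisfies σ (evalLit-satisfyingValue σ ℓ (trans σℓ σ₂ℓ))
       ∷ splice-components S z sat₁ sat₂
   , trans σz σ₁z
  where
  fromTrue : ∀ {x} → x ≡ true → T x
  fromTrue = Equivalence.from T-≡
  literalAwayFrom-z : Σ Lit λ ℓ → component S ∣ ℓ ∣ ≢ component S z ×
                        (∀ σ → evalLit σ ℓ ≡ true → T (evalLit σ a ∨ evalLit σ b))
  literalAwayFrom-z with component S ∣ a ∣ ≟ component S z
  ... | yes a∼z = b , (λ b∼z → a≁b (trans a∼z (sym b∼z)))
                    , λ _ → Equivalence.from T-∨ ∘ inj₂ ∘ fromTrue
  ... | no  a≁z = a , a≁z , λ _ → Equivalence.from T-∨ ∘ inj₁ ∘ fromTrue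

Forest⇒Satisfiable : ∀ S → Forest S → Satisfiable S
Forest⇒Satisfiable S forest =
  let σ , satisfies , _ = Forest⇒Satisfiable-at S forest 0 true in σ , satisfies

lemma11 : (G : FinGraph) → IsTree G → ¬ InU G
lemma11 G (_ , _ , acyclic) (S , (distinct , _) , simple , unsatisfiable , iso) =
  unsatisfiable (Forest⇒Satisfiable S (acyclic⇒Forest S distinct simple acyclicᴱ))
  where
  acyclicᴱ : ¬ Cycle (Edge S)
  acyclicᴱ = acyclic ∘ Iso-reflects-Cycle iso ∘ Cycle-Edge⇒Cycle-AdjOf S
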